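{- Let $G$ be a finite group, $X$ a finite $G$-set, $H$ a subgroup of $G$, $A$ a finite set with $|A|\ge2$, $a\in A$, $A'=A\setminus\{a\}$, and $N_c=\{0,1\}$. Then \[\varphi_{H,t}(J_{N_c,A,a}(X))=\prod_{i=1}^{\infty}(1+|A'|t^i)^{O_{X,H,i}},\] and in particular $\varphi_H(J_{N_c,A,a}(X))=|A|^{O_H(X)}$, where $O_{X,H,i}$ is the number of $H$-orbits of $X$ of cardinality $i$ and $O_H(X)$ is the number of $H$-orbits of $X$.
   Context: $A'^{[1]}$ is the set of maps $\{1\}\to A'$ (degree 1) and $A'^{[0]}=\{a\}$ (degree 0). $J_{N_c,A,a}(X)$ is the set of maps $f:X\to A'^{[0]}\sqcup A'^{[1]}$ with $G$-action $(gf)(x)=f(g^{ -1}x)$; $\deg f=\sum_x\deg f(x)$ and $J^n_{N_c,A,a}(X)=\{f:\deg f=n\}$. For a finite $G$-set $Z$, $\varphi_H(Z)$ is the number of points of $Z$ fixed by all of $H$, and $\varphi_{H,t}(J_{N_c,A,a}(X))=\sum_{n\ge0}\varphi_H(J^n_{N_c,A,a}(X))t^n$. -}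

module Defs where

open import Data.Nat using (ℕ; zero; suc; _+_; _*_; _∸_; _^_; _≤_)
open import Data.Nat.Properties using () renaming (_≟_ to _≟ℕ_)
open import Data.Bool using (Bool; true; false; _∧_; if_then_else_)
open import Data.Fin using (Fin; toℕ; _≟_)
open import Data.List using (List; []; _∷_; map; filter; length; upTo; allFin; concatMap; foldr)
open import Data.Nat.ListAction using (sum)
open import Data.List.Relation.Unary.All using (All)
open import Data.Maybe using (Maybe; just; nothing)
open import Data.Vec using (Vec; []; _∷_; lookup; toList)
open import Relation.Binary.PropositionalEquality using (_≡_; _≢_)
open import Relation.Nullary using (¬_; Dec; yes; no)
open import Relation.Nullary.Decidable using (⌊_⌋; ¬?)

record FinGroup : Set where
  field
    order : ℕ
    _·_   : Fin order → Fin order → Fin order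
    e     : Fin order
    inv   : Fin order → Fin order
    assoc : ∀ x y z → (x · y) · z ≡ x · (y · z)
    idˡ   : ∀ x → e · x ≡ x
    idʳ   : ∀ x → x · e ≡ x
    invˡ  : ∀ x → inv x · x ≡ e
    invʳ  : ∀ x → x · inv x ≡ e

open FinGroup public

record Subgroup (G : FinGroup) : Set where
  field
    mem     : Fin (order G) → Bool
    mem-e   : mem (e G) ≡ true
    mem-·   : ∀ x y → mem x ≡ true → mem y ≡ true → mem (_·_ G x y) ≡ true
    mem-inv : ∀ x → mem x ≡ true → mem (inv G x) ≡ true

open Subgroup public

record GSet (G : FinGroup) (n : ℕ) : Set where
  field
    act     : Fin (order G) → Fin n → Fin n
    act-e   : ∀ x → act (e G) x ≡ x
    act-·   : ∀ g h x → act (_·_ G g h) x ≡ act g (act h x)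

open GSet public

count : {A : Set} → (A → Bool) → List A → ℕ
count p []       = 0
count p (x ∷ xs) = (if p x then 1 else 0) + count p xs

anyL : {A : Set} → (A → Bool) → List A → Bool
anyL p []       = false
anyL p (x ∷ xs) = if p x then true else anyL p xs

allL : {A : Set} → (A → Bool) → List A → Bool
allL p []       = true
allL p (x ∷ xs) = if p x then allL p xs else false

allVecs : {A : Set} → List A → (n : ℕ) → List (Vec A n)
allVecs xs zero    = [] ∷ []
allVecs xs (suc n) = concatMap (λ v → map (λ x → x ∷ v) xs) (allVecs xs n)

module _ {G : FinGroup} (H : Subgroup G) {n : ℕ} (X : GSet G n) where

  inOrbit : Fin n → Fin n → Bool
  inOrbit x y = anyL (λ h → mem H h ∧ ⌊ act X h x ≟ y ⌋) (allFin (order G))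

  orbitSize : Fin n → ℕ
  orbitSize x = count (inOrbit x) (allFin n)

  isRep : Fin n → Bool
  isRep x = allL (λ y → if inOrbit x y then ⌊ toℕ x Data.Nat.≤? toℕ y ⌋ else true) (allFin n)

  numOrbits : ℕ
  numOrbits = count isRep (allFin n)

  numOrbitsOfSize : ℕ → ℕ
  numOrbitsOfSize i = count (λ x → isRep x ∧ ⌊ orbitSize x ≟ℕ i ⌋) (allFin n)

-- A'^{[0]} = {a} is encoded by `nothing` (degree 0);
-- A'^{[1]} = maps {1} → A' is encoded by `just b` with b ∈ A' (degree 1).
-- An element f : X → A'^{[0]} ⊔ A'^{[1]} is a vector over X = Fin n.

module _ {k : ℕ} (a : Fin k) where

  A′ : List (Fin k)
  A′ = filter (λ b → ¬? (b ≟ a)) (allFin k)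

  codomain : List (Maybe (Fin k))
  codomain = nothing ∷ map just A′

  J : (n : ℕ) → List (Vec (Maybe (Fin k)) n)
  J n = allVecs codomain n

degVal : {k : ℕ} → Maybe (Fin k) → ℕ
degVal nothing  = 0
degVal (just _) = 1

deg : {k n : ℕ} → Vec (Maybe (Fin k)) n → ℕ
deg f = sum (map degVal (toList f))

eqMaybeFin : {k : ℕ} → Maybe (Fin k) → Maybe (Fin k) → Bool
eqMaybeFin nothing  nothing  = true
eqMaybeFin nothing  (just _) = false
eqMaybeFin (just _) nothing  = false
eqMaybeFin (just x) (just y) = ⌊ x ≟ y ⌋

module _ {G : FinGroup} (H : Subgroup G) {n : ℕ} (X : GSet G n) {k : ℕ} where

  fixedBy : Vec (Maybe (Fin k)) n → Bool
  fixedBy f = allL (λ h → if mem H h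
                            then allL (λ x → eqMaybeFin (lookup f (act X (inv G h) x)) (lookup f x)) (allFin n)
                            else true)
                   (allFin (order G))

  φJ^ : (a : Fin k) → ℕ → ℕ
  φJ^ a d = count (λ f → fixedBy f ∧ ⌊ deg f ≟ℕ d ⌋) (J a n)

  φJ : (a : Fin k) → ℕ
  φJ a = count fixedBy (J a n)

Series : Set
Series = ℕ → ℕ

oneS : Series
oneS zero    = 1
oneS (suc _) = 0

_⊛_ : Series → Series → Series
(p ⊛ q) d = sum (map (λ j → p j * q (d ∸ j)) (upTo (suc d)))

powS : Series → ℕ → Series
powS p zero    = oneS
powS p (suc m) = p ⊛ powS p m

binomS : ℕ → ℕ → Series
binomS c i d = oneS d + (if ⌊ d ≟ℕ i ⌋ then c else 0)

prodS : ℕ → (ℕ → Series) → Series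
prodS zero    F = oneS
prodS (suc N) F = prodS N F ⊛ F (suc N)

module Submission where

-- Theorem 3.15.  A colouring is H-fixed iff it is constant on H-orbits, so restriction to the
-- canonical (least) orbit representatives is a bijection from fixed colourings onto colourings
-- that are `nothing` (the colour a) off the representatives; its inverse extends along orbits.
-- The degree of a fixed colouring is the weighted degree of its restriction, a non-base colour
-- at a representative x weighing |H·x|.  Counting vectors by weighted degree factorises over
-- the coordinates: the generating series of Cⁿ is the product of those of the coordinates,
-- namely 1 + |A'| t^{|H·x|} at a representative and 1 elsewhere.  Grouping the factors by orbit
-- size gives the product formula; factors of index i > N are 1 up to degree N and are dropped.
-- Ignoring degrees instead gives k colours at each of the O_H(X) representatives.

open import Defs
open import Data.Nat using (ℕ; zero; suc; _+_; _*_; _∸_; _^_; _≤_; _<_; _≤′_; ≤′-refl; ≤′-step; _≤?_; z≤n; s≤s)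
open import Data.Nat.Properties
open import Data.Bool using (Bool; true; false; _∧_; _∨_; not; if_then_else_)
open import Data.Bool.Properties using (∧-comm; ∧-identityʳ; ∧-zeroʳ; ¬-not)
import Data.Bool.Properties as Bool
open import Data.Fin as Fin using (Fin; Fin′; zero; suc; toℕ)
import Data.Fin.Properties as Fin
open import Data.List using (List; []; _∷_; map; _++_; concatMap; length; tabulate; allFin; applyUpTo; filter)
import Data.List.Properties as List
open import Data.List.Relation.Unary.All as All using (All; []; _∷_)
import Data.List.Relation.Unary.All.Properties as All
open import Data.List.Relation.Unary.Any as Any using (Any; here; there)
import Data.List.Relation.Unary.Any.Properties as Any
open import Data.Maybe using (Maybe; just; nothing; is-nothing)
import Data.Maybe.Properties as Maybe
open import Data.Vec as Vec using (Vec; []; _∷_; lookup)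
import Data.Vec.Properties as Vec
open import Data.Vec.Relation.Binary.Pointwise.Extensional using (ext; Pointwise-≡⇒≡)
open import Data.Nat.ListAction using (sum)
open import Algebra.Properties.Semiring.Sum +-*-semiring using (sum-syntax; ∑-comm; *-distribʳ-sum; sum-cong-≗; sum-replicate-zero)
open import Data.Nat.Tactic.RingSolver using (solve-∀)
open import Data.Product using (Σ-syntax; _×_; _,_; proj₁; proj₂)
open import Data.Empty using (⊥)
open import Function using (_∘_; id)
open import Relation.Nullary using (¬_; Dec; yes; no; does)
open import Relation.Nullary.Decidable using (⌊_⌋; ¬?; dec-true; dec-false; isYes≗does)
open import Relation.Binary.Definitions using (DecidableEquality)
open import Relation.Binary.PropositionalEquality using (_≡_; _≢_; _≗_; refl; sym; trans; cong; cong₂; subst; module ≡-Reasoning)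

𝟙 : Bool → ℕ
𝟙 b = if b then 1 else 0

does-sound : ∀ {P : Set} (P? : Dec P) → does P? ≡ true → P
does-sound (yes p) _ = p

-- Defs tests with ⌊_⌋ (isYes), which does not compute on decisions built from others;
-- our own tests use `does`, which does, and these lemmas translate between the two
⌊⌋-sound : ∀ {P : Set} (P? : Dec P) → ⌊ P? ⌋ ≡ true → P
⌊⌋-sound P? h = does-sound P? (trans (sym (isYes≗does P?)) h)

⌊⌋-true : ∀ {P : Set} (P? : Dec P) → P → ⌊ P? ⌋ ≡ true
⌊⌋-true P? p = trans (isYes≗does P?) (dec-true P? p)

⌊⌋-false : ∀ {P : Set} (P? : Dec P) → ¬ P → ⌊ P? ⌋ ≡ false
⌊⌋-false P? ¬p = trans (isYes≗does P?) (dec-false P? ¬p)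

does-sym : ∀ {A : Set} (_≟_ : DecidableEquality A) (u v : A) → does (u ≟ v) ≡ does (v ≟ u)
does-sym _≟_ u v with u ≟ v
... | yes refl = sym (dec-true (u ≟ u) refl)
... | no u≢v   = sym (dec-false (v ≟ u) (u≢v ∘ sym))

bool-ext : ∀ {b c : Bool} → (b ≡ true → c ≡ true) → (c ≡ true → b ≡ true) → b ≡ c
bool-ext {false} {false} _ _ = refl
bool-ext {false} {true}  _ g = g refl
bool-ext {true}  {false} f _ = sym (f refl)
bool-ext {true}  {true}  _ _ = refl

∧-sound : ∀ {b c} → b ∧ c ≡ true → b ≡ true × c ≡ true
∧-sound {true} c≡true = refl , c≡true

∧-complete : ∀ {b c} → b ≡ true → c ≡ true → b ∧ c ≡ true
∧-complete refl c≡true = c≡true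

⇒-sound : ∀ {b c} → (if b then c else true) ≡ true → b ≡ true → c ≡ true
⇒-sound h refl = h

⇒-complete : ∀ b {c} → (b ≡ true → c ≡ true) → (if b then c else true) ≡ true
⇒-complete true  h = h refl
⇒-complete false _ = refl

allL-sound : ∀ {A : Set} (p : A → Bool) xs → allL p xs ≡ true → All (λ x → p x ≡ true) xs
allL-sound p []       _ = []
allL-sound p (x ∷ xs) h with p x in px
... | true = px ∷ allL-sound p xs h

allL-complete : ∀ {A : Set} (p : A → Bool) {xs} → All (λ x → p x ≡ true) xs → allL p xs ≡ true
allL-complete p []         = refl
allL-complete p (px ∷ pxs) rewrite px = allL-complete p pxs

anyL-sound : ∀ {A : Set} (p : A → Bool) xs → anyL p xs ≡ true → Any (λ x → p x ≡ true) xs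
anyL-sound p (x ∷ xs) h with p x in px
... | true  = here px
... | false = there (anyL-sound p xs h)

anyL-complete : ∀ {A : Set} (p : A → Bool) {xs} → Any (λ x → p x ≡ true) xs → anyL p xs ≡ true
anyL-complete p (here px) rewrite px = refl
anyL-complete p {x ∷ _} (there pxs) with p x
... | true  = refl
... | false = anyL-complete p pxs

∀-sound : ∀ {m} (p : Fin m → Bool) → allL p (allFin m) ≡ true → ∀ i → p i ≡ true
∀-sound p h = All.tabulate⁻ (allL-sound p _ h)

∀-complete : ∀ {m} (p : Fin m → Bool) → (∀ i → p i ≡ true) → allL p (allFin m) ≡ true
∀-complete p h = allL-complete p (All.tabulate⁺ h)

∃-sound : ∀ {m} (p : Fin m → Bool) → anyL p (allFin m) ≡ true → Σ[ i ∈ Fin m ] p i ≡ true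
∃-sound p h = Any.tabulate⁻ (anyL-sound p _ h)

∃-complete : ∀ {m} (p : Fin m → Bool) (i : Fin m) → p i ≡ true → anyL p (allFin m) ≡ true
∃-complete p i pi = anyL-complete p (Any.tabulate⁺ i pi)

least : ∀ {m} (p : Fin m → Bool) (i : Fin m) → p i ≡ true →
        Σ[ j ∈ Fin m ] p j ≡ true × (∀ l → p l ≡ true → toℕ j ≤ toℕ l)
least {m} p i pi = from-smallest (Fin.¬∀⟶∃¬-smallest m (λ l → p l ≡ false) (λ l → p l Bool.≟ false) not-all-false)
  where
  not-all-false : ¬ (∀ l → p l ≡ false)
  not-all-false all with () ← trans (sym pi) (all i)
  from-smallest : Σ[ j ∈ Fin m ] ¬ (p j ≡ false) × (∀ (l : Fin′ j) → p (Fin.inject l) ≡ false) →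
                  Σ[ j ∈ Fin m ] p j ≡ true × (∀ l → p l ≡ true → toℕ j ≤ toℕ l)
  from-smallest (j , pj≢false , below) = j , ¬-not pj≢false , minimal
    where
    minimal : ∀ l → p l ≡ true → toℕ j ≤ toℕ l
    minimal l pl = ≮⇒≥ λ l<j → true≢false (trans (sym pl) (subst (λ u → p u ≡ false) (inject-fromℕ< l<j) (below (Fin.fromℕ< l<j))))
      where
      true≢false : true ≡ false → ⊥
      true≢false ()
      inject-fromℕ< : (l<j : toℕ l < toℕ j) → Fin.inject (Fin.fromℕ< l<j) ≡ l
      inject-fromℕ< l<j = Fin.toℕ-injective (trans (Fin.toℕ-inject _) (Fin.toℕ-fromℕ< l<j))

module _ {A : Set} where

  count-cong : ∀ {p q : A → Bool} xs → (∀ x → p x ≡ q x) → count p xs ≡ count q xs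
  count-cong []       _   = refl
  count-cong (x ∷ xs) p≗q = cong₂ _+_ (cong 𝟙 (p≗q x)) (count-cong xs p≗q)

  count-++ : ∀ (p : A → Bool) xs ys → count p (xs ++ ys) ≡ count p xs + count p ys
  count-++ p []       ys = refl
  count-++ p (x ∷ xs) ys = trans (cong (𝟙 (p x) +_) (count-++ p xs ys)) (sym (+-assoc (𝟙 (p x)) _ _))

  count-map : ∀ {B : Set} (p : B → Bool) (f : A → B) xs → count p (map f xs) ≡ count (p ∘ f) xs
  count-map p f []       = refl
  count-map p f (x ∷ xs) = cong (𝟙 (p (f x)) +_) (count-map p f xs)

  count-false : ∀ {p : A → Bool} xs → (∀ x → p x ≡ false) → count p xs ≡ 0
  count-false []       _     = refl
  count-false (x ∷ xs) never rewrite never x = count-false xs never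

  count-∧ˡ : ∀ c (p : A → Bool) xs → count (λ x → c ∧ p x) xs ≡ 𝟙 c * count p xs
  count-∧ˡ true  p xs = sym (+-identityʳ (count p xs))
  count-∧ˡ false p xs = count-false xs (λ _ → refl)

  count-const : ∀ c (xs : List A) → count (λ _ → c) xs ≡ 𝟙 c * length xs
  count-const c []       = sym (*-zeroʳ (𝟙 c))
  count-const c (x ∷ xs) = trans (cong (𝟙 c +_) (count-const c xs)) (sym (*-suc (𝟙 c) (length xs)))

  count-filter : ∀ (p : A → Bool) {P : A → Set} (P? : ∀ x → Dec (P x)) xs →
                 count p (filter P? xs) ≡ count (λ x → does (P? x) ∧ p x) xs
  count-filter p P? []       = refl
  count-filter p P? (x ∷ xs) with P? x
  ... | yes _ = cong (𝟙 (p x) +_) (count-filter p P? xs)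
  ... | no  _ = count-filter p P? xs

  length-filter : ∀ {P : A → Set} (P? : ∀ x → Dec (P x)) xs → length (filter P? xs) ≡ count (does ∘ P?) xs
  length-filter P? []       = refl
  length-filter P? (x ∷ xs) with P? x
  ... | yes _ = cong suc (length-filter P? xs)
  ... | no  _ = length-filter P? xs

  count-complement : ∀ (p : A → Bool) xs → count (not ∘ p) xs + count p xs ≡ length xs
  count-complement p []       = refl
  count-complement p (x ∷ xs) with p x
  ... | true  = trans (+-suc _ _) (cong suc (count-complement p xs))
  ... | false = cong suc (count-complement p xs)

  count-≤-length : ∀ (p : A → Bool) xs → count p xs ≤ length xs
  count-≤-length p []       = z≤n
  count-≤-length p (x ∷ xs) with p x
  ... | true  = s≤s (count-≤-length p xs)
  ... | false = m≤n⇒m≤1+n (count-≤-length p xs)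

  count-pos : ∀ {p : A → Bool} {xs} → Any (λ x → p x ≡ true) xs → 1 ≤ count p xs
  count-pos {p} {x ∷ xs} (here px) rewrite px = s≤s z≤n
  count-pos {p} {x ∷ xs} (there pxs)          = ≤-trans (count-pos pxs) (m≤n+m _ (𝟙 (p x)))

count-product : ∀ {U V W : Set} (pair : U → V → W) (q : W → Bool) (a : U → Bool) (b : V → Bool) →
                (∀ u v → q (pair u v) ≡ a u ∧ b v) →
                ∀ us vs → count q (concatMap (λ u → map (pair u) vs) us) ≡ count a us * count b vs
count-product pair q a b q≡ []       vs = refl
count-product pair q a b q≡ (u ∷ us) vs = begin
  count q (map (pair u) vs ++ concatMap (λ u → map (pair u) vs) us)
    ≡⟨ count-++ q (map (pair u) vs) _ ⟩
  count q (map (pair u) vs) + count q (concatMap (λ u → map (pair u) vs) us)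
    ≡⟨ cong₂ _+_ (trans (count-map q (pair u) vs) (count-cong vs (q≡ u))) (count-product pair q a b q≡ us vs) ⟩
  count (λ v → a u ∧ b v) vs + count a us * count b vs
    ≡⟨ cong (_+ count a us * count b vs) (count-∧ˡ (a u) b vs) ⟩
  𝟙 (a u) * count b vs + count a us * count b vs
    ≡⟨ *-distribʳ-+ (count b vs) (𝟙 (a u)) (count a us) ⟨
  count a (u ∷ us) * count b vs ∎
  where open ≡-Reasoning

count-tabulate : ∀ {A : Set} {m} (p : A → Bool) (f : Fin m → A) → count p (tabulate f) ≡ ∑[ i < m ] 𝟙 (p (f i))
count-tabulate {m = zero}  p f = refl
count-tabulate {m = suc m} p f = cong (𝟙 (p (f zero)) +_) (count-tabulate p (f ∘ suc))

count-allFin-suc : ∀ {m} (p : Fin (suc m) → Bool) → count p (allFin (suc m)) ≡ 𝟙 (p zero) + count (p ∘ suc) (allFin m)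
count-allFin-suc p = cong (𝟙 (p zero) +_) (trans (count-tabulate p suc) (sym (count-tabulate (p ∘ suc) id)))

if-then-0 : ∀ b c → (if b then c else 0) ≡ 𝟙 b * c
if-then-0 true  c = sym (+-identityʳ c)
if-then-0 false c = refl

∑-select : ∀ {m} (a : Fin m) (h : Fin m → ℕ) → ∑[ x < m ] (if does (x Fin.≟ a) then h x else 0) ≡ h a
∑-select {suc m} zero    h = trans (cong (h zero +_) (sum-replicate-zero m)) (+-identityʳ (h zero))
∑-select {suc m} (suc a) h = ∑-select a (h ∘ suc)

∑-fibres : ∀ {n m} (r : Fin n → Fin m) (h : Fin m → ℕ) →
           ∑[ y < n ] h (r y) ≡ ∑[ x < m ] (count (λ y → does (x Fin.≟ r y)) (allFin n) * h x)
∑-fibres {n} {m} r h = begin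
  ∑[ y < n ] h (r y)
    ≡⟨ sum-cong-≗ (λ y → ∑-select (r y) h) ⟨
  ∑[ y < n ] ∑[ x < m ] (if does (x Fin.≟ r y) then h x else 0)
    ≡⟨ ∑-comm (λ y x → if does (x Fin.≟ r y) then h x else 0) ⟩
  ∑[ x < m ] ∑[ y < n ] (if does (x Fin.≟ r y) then h x else 0)
    ≡⟨ sum-cong-≗ (λ x → sum-cong-≗ (λ y → if-then-0 (does (x Fin.≟ r y)) (h x))) ⟩
  ∑[ x < m ] ∑[ y < n ] (𝟙 (does (x Fin.≟ r y)) * h x)
    ≡⟨ sum-cong-≗ (λ x → *-distribʳ-sum (h x) (λ y → 𝟙 (does (x Fin.≟ r y)))) ⟨
  ∑[ x < m ] ((∑[ y < n ] 𝟙 (does (x Fin.≟ r y))) * h x)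
    ≡⟨ sum-cong-≗ (λ x → cong (_* h x) (count-tabulate (λ y → does (x Fin.≟ r y)) id)) ⟨
  ∑[ x < m ] (count (λ y → does (x Fin.≟ r y)) (allFin n) * h x) ∎
  where open ≡-Reasoning

infixl 7 _⊙_
infixl 6 _⊕_

-- the coefficients of the product p ⊛ q, written as a recursion on the first factor
_⊙_ : Series → Series → Series
(p ⊙ q) d = sum (applyUpTo (λ j → p j * q (d ∸ j)) (suc d))

_⊕_ : Series → Series → Series
(p ⊕ q) d = p d + q d

⊛≗⊙ : ∀ p q → p ⊛ q ≗ p ⊙ q
⊛≗⊙ p q d = cong sum (List.map-applyUpTo id (λ j → p j * q (d ∸ j)) (suc d))

⊙-congʳ-≤ : ∀ d p {q q′} → (∀ i → i ≤ d → q i ≡ q′ i) → (p ⊙ q) d ≡ (p ⊙ q′) d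
⊙-congʳ-≤ zero    p q≡ = cong (λ y → p 0 * y + 0) (q≡ 0 z≤n)
⊙-congʳ-≤ (suc d) p q≡ = cong₂ _+_ (cong (p 0 *_) (q≡ (suc d) ≤-refl))
                                   (⊙-congʳ-≤ d (p ∘ suc) (λ i i≤d → q≡ i (m≤n⇒m≤1+n i≤d)))

⊙-congʳ : ∀ p {q q′} → q ≗ q′ → p ⊙ q ≗ p ⊙ q′
⊙-congʳ p q≗ d = ⊙-congʳ-≤ d p (λ i _ → q≗ i)

⊙-stepʳ : ∀ d p q → (p ⊙ q) (suc d) ≡ (p ⊙ (q ∘ suc)) d + p (suc d) * q 0
⊙-stepʳ zero    p q = regroup (p 0 * q 1) (p 1 * q 0)
  where
  regroup : ∀ a b → a + (b + 0) ≡ a + 0 + b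
  regroup = solve-∀
⊙-stepʳ (suc d) p q = trans (cong (p 0 * q (suc (suc d)) +_) (⊙-stepʳ d (p ∘ suc) q))
                            (sym (+-assoc (p 0 * q (suc (suc d))) _ _))

⊙-comm : ∀ p q → p ⊙ q ≗ q ⊙ p
⊙-comm p q zero    = cong (_+ 0) (*-comm (p 0) (q 0))
⊙-comm p q (suc d) = begin
  p 0 * q (suc d) + ((p ∘ suc) ⊙ q) d  ≡⟨ cong₂ _+_ (*-comm (p 0) (q (suc d))) (⊙-comm (p ∘ suc) q d) ⟩
  q (suc d) * p 0 + (q ⊙ (p ∘ suc)) d  ≡⟨ +-comm (q (suc d) * p 0) _ ⟩
  (q ⊙ (p ∘ suc)) d + q (suc d) * p 0  ≡⟨ ⊙-stepʳ d q p ⟨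
  (q ⊙ p) (suc d)                       ∎
  where open ≡-Reasoning

⊙-congˡ : ∀ {p p′} → p ≗ p′ → ∀ q → p ⊙ q ≗ p′ ⊙ q
⊙-congˡ {p} {p′} p≗ q d = trans (⊙-comm p q d) (trans (⊙-congʳ q p≗ d) (⊙-comm q p′ d))

⊙-cong : ∀ {p p′ q q′} → p ≗ p′ → q ≗ q′ → p ⊙ q ≗ p′ ⊙ q′
⊙-cong {p′ = p′} {q = q} p≗ q≗ d = trans (⊙-congˡ p≗ q d) (⊙-congʳ p′ q≗ d)

⊙-vanishˡ : ∀ d p q → (∀ i → i ≤ d → p i ≡ 0) → (p ⊙ q) d ≡ 0
⊙-vanishˡ zero    p q p≡0 rewrite p≡0 0 z≤n = refl
⊙-vanishˡ (suc d) p q p≡0 rewrite p≡0 0 z≤n = ⊙-vanishˡ d (p ∘ suc) q (λ i i≤d → p≡0 (suc i) (s≤s i≤d))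

⊙-identityˡ : ∀ q → oneS ⊙ q ≗ q
⊙-identityˡ q zero    = trans (+-identityʳ _) (+-identityʳ (q 0))
⊙-identityˡ q (suc d) = trans (cong₂ _+_ (+-identityʳ (q (suc d))) (⊙-vanishˡ d (oneS ∘ suc) q (λ _ _ → refl)))
                              (+-identityʳ (q (suc d)))

⊙-identityʳ : ∀ p → p ⊙ oneS ≗ p
⊙-identityʳ p d = trans (⊙-comm p oneS d) (⊙-identityˡ p d)

⊙-distribʳ-⊕ : ∀ p p′ q → (p ⊕ p′) ⊙ q ≗ p ⊙ q ⊕ p′ ⊙ q
⊙-distribʳ-⊕ p p′ q zero    = regroup (p 0) (p′ 0) (q 0)
  where
  regroup : ∀ a b c → (a + b) * c + 0 ≡ (a * c + 0) + (b * c + 0)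
  regroup = solve-∀
⊙-distribʳ-⊕ p p′ q (suc d) = trans (cong ((p 0 + p′ 0) * q (suc d) +_) (⊙-distribʳ-⊕ (p ∘ suc) (p′ ∘ suc) q d))
                                    (regroup (p 0) (p′ 0) (q (suc d)) _ _)
  where
  regroup : ∀ a b c x y → (a + b) * c + (x + y) ≡ (a * c + x) + (b * c + y)
  regroup = solve-∀

⊙-scaleˡ : ∀ c p q d → ((λ i → c * p i) ⊙ q) d ≡ c * (p ⊙ q) d
⊙-scaleˡ c p q zero    = regroup c (p 0) (q 0)
  where
  regroup : ∀ c a b → c * a * b + 0 ≡ c * (a * b + 0)
  regroup = solve-∀
⊙-scaleˡ c p q (suc d) = trans (cong (c * p 0 * q (suc d) +_) (⊙-scaleˡ c (p ∘ suc) q d))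
                               (regroup c (p 0) (q (suc d)) _)
  where
  regroup : ∀ c a b x → c * a * b + c * x ≡ c * (a * b + x)
  regroup = solve-∀

⊙-assoc : ∀ p q r → (p ⊙ q) ⊙ r ≗ p ⊙ (q ⊙ r)
⊙-assoc p q r zero    = regroup (p 0) (q 0) (r 0)
  where
  regroup : ∀ a b c → (a * b + 0) * c + 0 ≡ a * (b * c + 0) + 0
  regroup = solve-∀
⊙-assoc p q r (suc d) = begin
  (p ⊙ q) 0 * r (suc d) + (((λ i → p 0 * q (suc i)) ⊕ ((p ∘ suc) ⊙ q)) ⊙ r) d
    ≡⟨ cong ((p ⊙ q) 0 * r (suc d) +_) (⊙-distribʳ-⊕ (λ i → p 0 * q (suc i)) ((p ∘ suc) ⊙ q) r d) ⟩
  (p ⊙ q) 0 * r (suc d) + (((λ i → p 0 * q (suc i)) ⊙ r) d + (((p ∘ suc) ⊙ q) ⊙ r) d)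
    ≡⟨ cong₂ (λ x y → (p ⊙ q) 0 * r (suc d) + (x + y)) (⊙-scaleˡ (p 0) (q ∘ suc) r d) (⊙-assoc (p ∘ suc) q r d) ⟩
  (p 0 * q 0 + 0) * r (suc d) + (p 0 * ((q ∘ suc) ⊙ r) d + ((p ∘ suc) ⊙ (q ⊙ r)) d)
    ≡⟨ regroup (p 0) (q 0) (r (suc d)) _ _ ⟩
  p 0 * (q 0 * r (suc d) + ((q ∘ suc) ⊙ r) d) + ((p ∘ suc) ⊙ (q ⊙ r)) d ∎
  where
  open ≡-Reasoning
  regroup : ∀ a b c x y → (a * b + 0) * c + (a * x + y) ≡ a * (b * c + x) + y
  regroup = solve-∀

prodS-cong : ∀ N {F F′ : ℕ → Series} → (∀ i → i ≤ N → F i ≗ F′ i) → prodS N F ≗ prodS N F′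
prodS-cong zero    _  _ = refl
prodS-cong (suc N) {F} {F′} F≗F′ d = begin
  prodS (suc N) F d           ≡⟨ ⊛≗⊙ (prodS N F) (F (suc N)) d ⟩
  (prodS N F ⊙ F (suc N)) d   ≡⟨ ⊙-cong (prodS-cong N (λ i i≤N → F≗F′ i (m≤n⇒m≤1+n i≤N))) (F≗F′ (suc N) ≤-refl) d ⟩
  (prodS N F′ ⊙ F′ (suc N)) d ≡⟨ ⊛≗⊙ (prodS N F′) (F′ (suc N)) d ⟨
  prodS (suc N) F′ d          ∎
  where open ≡-Reasoning

prodS-ones : ∀ N → prodS N (λ _ → oneS) ≗ oneS
prodS-ones zero    _ = refl
prodS-ones (suc N) d = trans (⊛≗⊙ (prodS N (λ _ → oneS)) oneS d) (trans (⊙-identityʳ (prodS N (λ _ → oneS)) d) (prodS-ones N d))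

prodS-absorb : ∀ N {F F′ : ℕ → Series} (G : Series) {s} → 1 ≤ s → s ≤ N →
               F′ s ≗ G ⊙ F s → (∀ i → i ≢ s → F′ i ≗ F i) → prodS N F ⊙ G ≗ prodS N F′
prodS-absorb zero G () z≤n
prodS-absorb (suc N) {F} {F′} G {s} 1≤s s≤N F′s≗ F′i≗ d with s ≟ suc N
... | yes refl = begin
  (prodS (suc N) F ⊙ G) d          ≡⟨ ⊙-congˡ (⊛≗⊙ (prodS N F) (F (suc N))) G d ⟩
  (prodS N F ⊙ F (suc N) ⊙ G) d    ≡⟨ ⊙-assoc (prodS N F) (F (suc N)) G d ⟩
  (prodS N F ⊙ (F (suc N) ⊙ G)) d  ≡⟨ ⊙-cong below top d ⟩
  (prodS N F′ ⊙ F′ (suc N)) d      ≡⟨ ⊛≗⊙ (prodS N F′) (F′ (suc N)) d ⟨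
  prodS (suc N) F′ d               ∎
  where
  open ≡-Reasoning
  below : prodS N F ≗ prodS N F′
  below = prodS-cong N (λ i i≤N e → sym (F′i≗ i (<⇒≢ (s≤s i≤N)) e))
  top : F (suc N) ⊙ G ≗ F′ (suc N)
  top e = trans (⊙-comm (F (suc N)) G e) (sym (F′s≗ e))
... | no s≢1+N = begin
  (prodS (suc N) F ⊙ G) d          ≡⟨ ⊙-congˡ (⊛≗⊙ (prodS N F) (F (suc N))) G d ⟩
  (prodS N F ⊙ F (suc N) ⊙ G) d    ≡⟨ ⊙-assoc (prodS N F) (F (suc N)) G d ⟩
  (prodS N F ⊙ (F (suc N) ⊙ G)) d  ≡⟨ ⊙-congʳ (prodS N F) (⊙-comm (F (suc N)) G) d ⟩
  (prodS N F ⊙ (G ⊙ F (suc N))) d  ≡⟨ ⊙-assoc (prodS N F) G (F (suc N)) d ⟨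
  (prodS N F ⊙ G ⊙ F (suc N)) d    ≡⟨ ⊙-cong absorbed top d ⟩
  (prodS N F′ ⊙ F′ (suc N)) d      ≡⟨ ⊛≗⊙ (prodS N F′) (F′ (suc N)) d ⟨
  prodS (suc N) F′ d               ∎
  where
  open ≡-Reasoning
  absorbed : prodS N F ⊙ G ≗ prodS N F′
  absorbed = prodS-absorb N G 1≤s (≤-pred (≤∧≢⇒< s≤N s≢1+N)) F′s≗ F′i≗
  top : F (suc N) ≗ F′ (suc N)
  top e = sym (F′i≗ (suc N) (s≢1+N ∘ sym) e)

binomS-below : ∀ c i e → e < i → binomS c i e ≡ oneS e
binomS-below c i e e<i rewrite ⌊⌋-false (e ≟ i) (<⇒≢ e<i) = +-identityʳ (oneS e)

powS-one-≤ : ∀ N p → (∀ e → e ≤ N → p e ≡ oneS e) → ∀ m e → e ≤ N → powS p m e ≡ oneS e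
powS-one-≤ N p p≡1 zero    e e≤N = refl
powS-one-≤ N p p≡1 (suc m) e e≤N = begin
  powS p (suc m) e  ≡⟨ ⊛≗⊙ p (powS p m) e ⟩
  (p ⊙ powS p m) e  ≡⟨ ⊙-congʳ-≤ e p (λ i i≤e → powS-one-≤ N p p≡1 m i (≤-trans i≤e e≤N)) ⟩
  (p ⊙ oneS) e      ≡⟨ ⊙-identityʳ p e ⟩
  p e               ≡⟨ p≡1 e e≤N ⟩
  oneS e            ∎
  where open ≡-Reasoning

prodS-truncate : ∀ N F M → N ≤′ M → (∀ i → N < i → ∀ e → e ≤ N → F i e ≡ oneS e) →
                 ∀ d → d ≤ N → prodS M F d ≡ prodS N F d
prodS-truncate N F .N      ≤′-refl         _   d d≤N = refl
prodS-truncate N F (suc M) (≤′-step N≤′M) F≡1 d d≤N = begin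
  prodS (suc M) F d         ≡⟨ ⊛≗⊙ (prodS M F) (F (suc M)) d ⟩
  (prodS M F ⊙ F (suc M)) d ≡⟨ ⊙-congʳ-≤ d (prodS M F) (λ e e≤d → F≡1 (suc M) (s≤s (≤′⇒≤ N≤′M)) e (≤-trans e≤d d≤N)) ⟩
  (prodS M F ⊙ oneS) d      ≡⟨ ⊙-identityʳ (prodS M F) d ⟩
  prodS M F d               ≡⟨ prodS-truncate N F M N≤′M F≡1 d d≤N ⟩
  prodS N F d               ∎
  where open ≡-Reasoning

∏ₛ : (n : ℕ) → (Fin n → Series) → Series
∏ₛ zero    E = oneS
∏ₛ (suc n) E = ∏ₛ n (E ∘ suc) ⊙ E zero

∏ₛ-cong : ∀ n {E E′ : Fin n → Series} → (∀ x → E x ≗ E′ x) → ∏ₛ n E ≗ ∏ₛ n E′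
∏ₛ-cong zero    _    _ = refl
∏ₛ-cong (suc n) E≗E′ d = ⊙-cong (∏ₛ-cong n (E≗E′ ∘ suc)) (E≗E′ zero) d

prodS-pow-step : ∀ (B : ℕ → Series) N (m : ℕ → ℕ) {s} → 1 ≤ s → s ≤ N →
                 prodS N (λ i → powS (B i) (m i)) ⊙ B s ≗ prodS N (λ i → powS (B i) (𝟙 ⌊ s ≟ i ⌋ + m i))
prodS-pow-step B N m {s} 1≤s s≤N = prodS-absorb N (B s) 1≤s s≤N at-s elsewhere
  where
  at-s : powS (B s) (𝟙 ⌊ s ≟ s ⌋ + m s) ≗ B s ⊙ powS (B s) (m s)
  at-s e = trans (cong (λ b → powS (B s) (𝟙 b + m s) e) (⌊⌋-true (s ≟ s) refl)) (⊛≗⊙ (B s) (powS (B s) (m s)) e)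
  elsewhere : ∀ i → i ≢ s → powS (B i) (𝟙 ⌊ s ≟ i ⌋ + m i) ≗ powS (B i) (m i)
  elsewhere i i≢s e = cong (λ b → powS (B i) (𝟙 b + m i) e) (⌊⌋-false (s ≟ i) (i≢s ∘ sym))

∏ₛ-group : ∀ (B : ℕ → Series) N {n} (b : Fin n → Bool) (s : Fin n → ℕ) →
           (∀ x → b x ≡ true → 1 ≤ s x × s x ≤ N) →
           ∏ₛ n (λ x → if b x then B (s x) else oneS)
             ≗ prodS N (λ i → powS (B i) (count (λ x → b x ∧ ⌊ s x ≟ i ⌋) (allFin n)))
∏ₛ-group B N {zero}  b s _      d = sym (prodS-ones N d)
∏ₛ-group B N {suc n} b s bounds d = begin
  (∏ₛ n (E ∘ suc) ⊙ E zero) d                    ≡⟨ ⊙-congˡ (∏ₛ-group B N (b ∘ suc) (s ∘ suc) (bounds ∘ suc)) (E zero) d ⟩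
  (prodS N (λ i → powS (B i) (rest i)) ⊙ E zero) d ≡⟨ first-factor (b zero) refl d ⟩
  prodS N (λ i → powS (B i) (all i)) d           ∎
  where
  open ≡-Reasoning
  E : Fin (suc n) → Series
  E x = if b x then B (s x) else oneS
  rest all : ℕ → ℕ
  rest i = count (λ x → b (suc x) ∧ ⌊ s (suc x) ≟ i ⌋) (allFin n)
  all  i = count (λ x → b x ∧ ⌊ s x ≟ i ⌋) (allFin (suc n))
  all≡ : ∀ c → b zero ≡ c → ∀ i → all i ≡ 𝟙 (c ∧ ⌊ s zero ≟ i ⌋) + rest i
  all≡ c refl i = count-allFin-suc (λ x → b x ∧ ⌊ s x ≟ i ⌋)
  first-factor : ∀ c → b zero ≡ c → prodS N (λ i → powS (B i) (rest i)) ⊙ E zero ≗ prodS N (λ i → powS (B i) (all i))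
  first-factor c b0≡c e = begin
    (prodS N (λ i → powS (B i) (rest i)) ⊙ E zero) e
      ≡⟨ ⊙-congʳ (prodS N (λ i → powS (B i) (rest i))) (λ e′ → cong (λ c → (if c then B (s zero) else oneS) e′) b0≡c) e ⟩
    (prodS N (λ i → powS (B i) (rest i)) ⊙ (if c then B (s zero) else oneS)) e
      ≡⟨ absorb c b0≡c ⟩
    prodS N (λ i → powS (B i) (𝟙 (c ∧ ⌊ s zero ≟ i ⌋) + rest i)) e
      ≡⟨ prodS-cong N (λ i _ e′ → cong (λ m → powS (B i) m e′) (sym (all≡ c b0≡c i))) e ⟩
    prodS N (λ i → powS (B i) (all i)) e ∎
    where
    absorb : ∀ c → b zero ≡ c → (prodS N (λ i → powS (B i) (rest i)) ⊙ (if c then B (s zero) else oneS)) e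
                                  ≡ prodS N (λ i → powS (B i) (𝟙 (c ∧ ⌊ s zero ≟ i ⌋) + rest i)) e
    absorb false _    = ⊙-identityʳ (prodS N (λ i → powS (B i) (rest i))) e
    absorb true  b0≡c = prodS-pow-step B N rest (proj₁ (bounds zero b0≡c)) (proj₂ (bounds zero b0≡c)) e

mono : ℕ → Series
mono s e = 𝟙 (does (s ≟ e))

mono-zero : mono 0 ≗ oneS
mono-zero zero    = refl
mono-zero (suc _) = refl

countS : ∀ {U : Set} → List U → (U → Bool) → (U → ℕ) → Series
countS us a α e = count (λ u → a u ∧ does (α u ≟ e)) us

mono-⊙-countS : ∀ {V : Set} s d (vs : List V) b β →
                (mono s ⊙ countS vs b β) d ≡ count (λ v → b v ∧ does (s + β v ≟ d)) vs
mono-⊙-countS zero    d       vs b β = trans (⊙-congˡ mono-zero (countS vs b β) d) (⊙-identityˡ (countS vs b β) d)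
mono-⊙-countS (suc s) zero    vs b β = sym (count-false vs (λ v → ∧-zeroʳ (b v)))
mono-⊙-countS (suc s) (suc d) vs b β = mono-⊙-countS s d vs b β

count-pairs : ∀ {U V W : Set} d (pair : U → V → W) (q : W → Bool) a α b β →
              (∀ u v → q (pair u v) ≡ (a u ∧ b v) ∧ does (α u + β v ≟ d)) →
              ∀ us vs → count q (concatMap (λ u → map (pair u) vs) us) ≡ (countS us a α ⊙ countS vs b β) d
count-pairs d pair q a α b β q≡ []       vs = sym (⊙-vanishˡ d (countS [] a α) (countS vs b β) (λ _ _ → refl))
count-pairs d pair q a α b β q≡ (u ∷ us) vs = begin
  count q (map (pair u) vs ++ concatMap (λ u → map (pair u) vs) us)
    ≡⟨ count-++ q (map (pair u) vs) _ ⟩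
  count q (map (pair u) vs) + count q (concatMap (λ u → map (pair u) vs) us)
    ≡⟨ cong₂ _+_ (trans (count-map q (pair u) vs) (trans (count-cong vs (q≡ u)) (pairs-with-u (a u))))
                 (count-pairs d pair q a α b β q≡ us vs) ⟩
  (term (a u) ⊙ countS vs b β) d + (countS us a α ⊙ countS vs b β) d
    ≡⟨ ⊙-distribʳ-⊕ (term (a u)) (countS us a α) (countS vs b β) d ⟨
  (countS (u ∷ us) a α ⊙ countS vs b β) d ∎
  where
  open ≡-Reasoning
  term : Bool → Series
  term c e = 𝟙 (c ∧ does (α u ≟ e))
  pairs-with-u : ∀ c → count (λ v → (c ∧ b v) ∧ does (α u + β v ≟ d)) vs ≡ (term c ⊙ countS vs b β) d
  pairs-with-u true  = sym (mono-⊙-countS (α u) d vs b β)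
  pairs-with-u false = trans (count-false vs (λ _ → refl)) (sym (⊙-vanishˡ d (λ _ → 0) (countS vs b β) (λ _ _ → refl)))

allAt : ∀ {A : Set} {n} → (Fin n → A → Bool) → Vec A n → Bool
allAt P []      = true
allAt P (z ∷ v) = P zero z ∧ allAt (P ∘ suc) v

allAt-sound : ∀ {A : Set} {n} (P : Fin n → A → Bool) v → allAt P v ≡ true → ∀ x → P x (lookup v x) ≡ true
allAt-sound P (z ∷ v) h zero    = proj₁ (∧-sound h)
allAt-sound P (z ∷ v) h (suc x) = allAt-sound (P ∘ suc) v (proj₂ (∧-sound h)) x

allAt-complete : ∀ {A : Set} {n} (P : Fin n → A → Bool) v → (∀ x → P x (lookup v x) ≡ true) → allAt P v ≡ true
allAt-complete P []      _ = refl
allAt-complete P (z ∷ v) h = ∧-complete (h zero) (allAt-complete (P ∘ suc) v (h ∘ suc))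

weight : ∀ {A : Set} {n} → (Fin n → A → ℕ) → Vec A n → ℕ
weight {n = n} W v = ∑[ x < n ] W x (lookup v x)

vectors-series : ∀ {A : Set} (C : List A) n (P : Fin n → A → Bool) (W : Fin n → A → ℕ) d →
                 count (λ v → allAt P v ∧ does (weight W v ≟ d)) (allVecs C n) ≡ ∏ₛ n (λ x → countS C (P x) (W x)) d
vectors-series C zero    P W zero    = refl
vectors-series C zero    P W (suc d) = refl
vectors-series C (suc n) P W d = begin
  count (λ v → allAt P v ∧ does (weight W v ≟ d)) (concatMap (λ v → map (_∷ v) C) (allVecs C n))
    ≡⟨ count-pairs d (λ v z → z ∷ v) _ (allAt (P ∘ suc)) (weight (W ∘ suc)) (P zero) (W zero) tail-first (allVecs C n) C ⟩
  (countS (allVecs C n) (allAt (P ∘ suc)) (weight (W ∘ suc)) ⊙ countS C (P zero) (W zero)) d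
    ≡⟨ ⊙-congˡ (vectors-series C n (P ∘ suc) (W ∘ suc)) (countS C (P zero) (W zero)) d ⟩
  ∏ₛ (suc n) (λ x → countS C (P x) (W x)) d ∎
  where
  open ≡-Reasoning
  tail-first : ∀ v z → (P zero z ∧ allAt (P ∘ suc) v) ∧ does (W zero z + weight (W ∘ suc) v ≟ d)
                       ≡ (allAt (P ∘ suc) v ∧ P zero z) ∧ does (weight (W ∘ suc) v + W zero z ≟ d)
  tail-first v z = cong₂ _∧_ (∧-comm (P zero z) _) (cong (λ m → does (m ≟ d)) (+-comm (W zero z) _))

count-allAt : ∀ {A : Set} (C : List A) {n} (P : Fin n → A → Bool) (b : Fin n → Bool) k →
              (∀ x → count (P x) C ≡ (if b x then k else 1)) → count (allAt P) (allVecs C n) ≡ k ^ count b (allFin n)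
count-allAt C {zero}  P b k choices = refl
count-allAt C {suc n} P b k choices = begin
  count (allAt P) (concatMap (λ v → map (_∷ v) C) (allVecs C n))
    ≡⟨ count-product (λ v z → z ∷ v) (allAt P) (allAt (P ∘ suc)) (P zero) (λ v z → ∧-comm (P zero z) _) (allVecs C n) C ⟩
  count (allAt (P ∘ suc)) (allVecs C n) * count (P zero) C
    ≡⟨ cong₂ _*_ (count-allAt C (P ∘ suc) (b ∘ suc) k (choices ∘ suc)) (choices zero) ⟩
  k ^ count (b ∘ suc) (allFin n) * (if b zero then k else 1)
    ≡⟨ one-more (b zero) ⟩
  k ^ (𝟙 (b zero) + count (b ∘ suc) (allFin n))
    ≡⟨ cong (k ^_) (count-allFin-suc b) ⟨
  k ^ count b (allFin (suc n)) ∎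
  where
  open ≡-Reasoning
  one-more : ∀ c → k ^ count (b ∘ suc) (allFin n) * (if c then k else 1) ≡ k ^ (𝟙 c + count (b ∘ suc) (allFin n))
  one-more true  = *-comm (k ^ count (b ∘ suc) (allFin n)) k
  one-more false = *-identityʳ (k ^ count (b ∘ suc) (allFin n))

record Enumerates {A : Set} (_≟_ : DecidableEquality A) (Good : A → Set) (L : List A) : Set where
  field
    only-good : All Good L
    once      : ∀ x → Good x → count (λ y → does (y ≟ x)) L ≡ 1

module _ {A : Set} where

  count≡sum : ∀ (p : A → Bool) xs → count p xs ≡ sum (map (𝟙 ∘ p) xs)
  count≡sum p []       = refl
  count≡sum p (x ∷ xs) = cong (𝟙 (p x) +_) (count≡sum p xs)

  sum-map-+ : ∀ (f g : A → ℕ) xs → sum (map (λ x → f x + g x) xs) ≡ sum (map f xs) + sum (map g xs)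
  sum-map-+ f g []       = refl
  sum-map-+ f g (x ∷ xs) = trans (cong (f x + g x +_) (sum-map-+ f g xs)) (interchange (f x) (g x) _ _)
    where
    interchange : ∀ a b c d → a + b + (c + d) ≡ a + c + (b + d)
    interchange = solve-∀

  sum-map-zero : ∀ (xs : List A) → sum (map (λ _ → 0) xs) ≡ 0
  sum-map-zero []       = refl
  sum-map-zero (x ∷ xs) = sum-map-zero xs

  sum-map-cong-All : ∀ {Good : A → Set} {f g : A → ℕ} {xs} → All Good xs → (∀ x → Good x → f x ≡ g x) →
                     sum (map f xs) ≡ sum (map g xs)
  sum-map-cong-All []         _  = refl
  sum-map-cong-All (gx ∷ gxs) f≡ = cong₂ _+_ (f≡ _ gx) (sum-map-cong-All gxs f≡)

count-fibres : ∀ {A B : Set} (_≟_ : DecidableEquality B) (key : A → B) (p : A → Bool) (M : List B) xs →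
               All (λ x → p x ≡ true → count (λ y → does (key x ≟ y)) M ≡ 1) xs →
               count p xs ≡ sum (map (λ y → count (λ x → p x ∧ does (key x ≟ y)) xs) M)
count-fibres _≟_ key p M []       []             = sym (sum-map-zero M)
count-fibres _≟_ key p M (x ∷ xs) (x-once ∷ rest) = begin
  𝟙 (p x) + count p xs
    ≡⟨ cong₂ _+_ (fibre-of-x (p x) refl) (count-fibres _≟_ key p M xs rest) ⟩
  sum (map (λ y → 𝟙 (p x ∧ does (key x ≟ y))) M) + sum (map (λ y → count (λ x → p x ∧ does (key x ≟ y)) xs) M)
    ≡⟨ sum-map-+ (λ y → 𝟙 (p x ∧ does (key x ≟ y))) _ M ⟨
  sum (map (λ y → count (λ x → p x ∧ does (key x ≟ y)) (x ∷ xs)) M) ∎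
  where
  open ≡-Reasoning
  fibre-of-x : ∀ c → p x ≡ c → 𝟙 c ≡ sum (map (λ y → 𝟙 (c ∧ does (key x ≟ y))) M)
  fibre-of-x true  px = trans (sym (x-once px)) (count≡sum (λ y → does (key x ≟ y)) M)
  fibre-of-x false _  = sym (sum-map-zero M)

count-bijection : ∀ {A : Set} {_≟_ : DecidableEquality A} {Good : A → Set} {L : List A} → Enumerates _≟_ Good L →
                  (φ ψ : A → A) → (∀ x → Good x → Good (φ x)) → (∀ y → Good y → Good (ψ y)) →
                  (p q : A → Bool) →
                  (∀ x → p x ≡ true → q (φ x) ≡ true × ψ (φ x) ≡ x) →
                  (∀ y → q y ≡ true → p (ψ y) ≡ true × φ (ψ y) ≡ y) →
                  count p L ≡ count q L
count-bijection {_≟_ = _≟_} {Good} {L} enum φ ψ φ-good ψ-good p q p⇒ q⇒ = begin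
  count p L
    ≡⟨ count-fibres _≟_ φ p L L (All.map (λ {x} gx _ → image-once x gx) only-good) ⟩
  sum (map (λ y → count (λ x → p x ∧ does (φ x ≟ y)) L) L)
    ≡⟨ sum-map-cong-All only-good fibre ⟩
  sum (map (𝟙 ∘ q) L)
    ≡⟨ count≡sum q L ⟨
  count q L ∎
  where
  open ≡-Reasoning
  open Enumerates enum
  image-once : ∀ x → Good x → count (λ y → does (φ x ≟ y)) L ≡ 1
  image-once x gx = trans (count-cong L (does-sym _≟_ (φ x))) (once (φ x) (φ-good x gx))
  -- the fibre of φ over y is {ψ y} when q y holds, and empty otherwise
  in-fibre : ∀ y x → (p x ∧ does (φ x ≟ y)) ≡ (q y ∧ does (x ≟ ψ y))
  in-fibre y x = bool-ext to from
    where
    to : p x ∧ does (φ x ≟ y) ≡ true → q y ∧ does (x ≟ ψ y) ≡ true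
    to h with px , φx≟y ← ∧-sound h with refl ← does-sound (φ x ≟ y) φx≟y
      = ∧-complete (proj₁ (p⇒ x px)) (dec-true (x ≟ ψ (φ x)) (sym (proj₂ (p⇒ x px))))
    from : q y ∧ does (x ≟ ψ y) ≡ true → p x ∧ does (φ x ≟ y) ≡ true
    from h with qy , x≟ψy ← ∧-sound h with refl ← does-sound (x ≟ ψ y) x≟ψy
      = ∧-complete (proj₁ (q⇒ y qy)) (dec-true (φ (ψ y) ≟ y) (proj₂ (q⇒ y qy)))
  fibre : ∀ y → Good y → count (λ x → p x ∧ does (φ x ≟ y)) L ≡ 𝟙 (q y)
  fibre y gy = begin
    count (λ x → p x ∧ does (φ x ≟ y)) L  ≡⟨ count-cong L (in-fibre y) ⟩
    count (λ x → q y ∧ does (x ≟ ψ y)) L  ≡⟨ count-∧ˡ (q y) (λ x → does (x ≟ ψ y)) L ⟩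
    𝟙 (q y) * count (λ x → does (x ≟ ψ y)) L ≡⟨ cong (𝟙 (q y) *_) (once (ψ y) (ψ-good y gy)) ⟩
    𝟙 (q y) * 1                           ≡⟨ *-identityʳ (𝟙 (q y)) ⟩
    𝟙 (q y)                               ∎

allVecs-enumerates : ∀ {A : Set} {_≟_ : DecidableEquality A} {Good : A → Set} {C : List A} →
                     Enumerates _≟_ Good C → ∀ n → Enumerates (Vec.≡-dec _≟_) (λ v → ∀ x → Good (lookup v x)) (allVecs C n)
allVecs-enumerates enum zero = record { only-good = (λ ()) ∷ [] ; once = λ { [] _ → refl } }
allVecs-enumerates {_≟_ = _≟_} {Good} {C} enum (suc n) = record { only-good = good-vectors ; once = vector-once }
  where
  open Enumerates enum
  module Tails = Enumerates (allVecs-enumerates enum n)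
  good-vectors : All (λ v → ∀ x → Good (lookup v x)) (allVecs C (suc n))
  good-vectors = All.concat⁺ (All.map⁺ (All.map (λ gv → All.map⁺ (All.map (λ gz → λ { zero → gz ; (suc x) → gv x }) only-good))
                                                 Tails.only-good))
  vector-once : ∀ v → (∀ x → Good (lookup v x)) → count (λ w → does (Vec.≡-dec _≟_ w v)) (allVecs C (suc n)) ≡ 1
  vector-once (z ∷ v) gv = begin
    count (λ w → does (Vec.≡-dec _≟_ w (z ∷ v))) (concatMap (λ u → map (_∷ u) C) (allVecs C n))
      ≡⟨ count-product (λ u y → y ∷ u) _ (λ u → does (Vec.≡-dec _≟_ u v)) (λ y → does (y ≟ z))
                       (λ u y → ∧-comm (does (y ≟ z)) _) (allVecs C n) C ⟩
    count (λ u → does (Vec.≡-dec _≟_ u v)) (allVecs C n) * count (λ y → does (y ≟ z)) C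
      ≡⟨ cong₂ _*_ (Tails.once v (gv ∘ suc)) (once z (gv zero)) ⟩
    1 ∎
    where open ≡-Reasoning

module Orbits (G : FinGroup) (H : Subgroup G) {n : ℕ} (X : GSet G n) where

  Orbit : Fin n → Fin n → Set
  Orbit x y = Σ[ h ∈ Fin (order G) ] mem H h ≡ true × act X h x ≡ y

  inOrbit-sound : ∀ x y → inOrbit H X x y ≡ true → Orbit x y
  inOrbit-sound x y h
    with g , ok ← ∃-sound (λ g → mem H g ∧ ⌊ act X g x Fin.≟ y ⌋) h
    with g∈H , gx≟y ← ∧-sound ok
    = g , g∈H , ⌊⌋-sound (act X g x Fin.≟ y) gx≟y

  inOrbit-complete : ∀ x y → Orbit x y → inOrbit H X x y ≡ true
  inOrbit-complete x y (g , g∈H , gx≡y) =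
    ∃-complete (λ g → mem H g ∧ ⌊ act X g x Fin.≟ y ⌋) g (∧-complete g∈H (⌊⌋-true (act X g x Fin.≟ y) gx≡y))

  orbit-refl : ∀ x → Orbit x x
  orbit-refl x = e G , mem-e H , act-e X x

  act-inv : ∀ g x → act X (inv G g) (act X g x) ≡ x
  act-inv g x = trans (sym (act-· X (inv G g) g x)) (trans (cong (λ h → act X h x) (invˡ G g)) (act-e X x))

  orbit-sym : ∀ {x y} → Orbit x y → Orbit y x
  orbit-sym {x} (g , g∈H , refl) = inv G g , mem-inv H g g∈H , act-inv g x

  orbit-trans : ∀ {x y z} → Orbit x y → Orbit y z → Orbit x z
  orbit-trans {x} (g , g∈H , refl) (h , h∈H , refl) = _·_ G h g , mem-· H h g h∈H g∈H , act-· X h g x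

  isRep-sound : ∀ x → isRep H X x ≡ true → ∀ y → Orbit x y → toℕ x ≤ toℕ y
  isRep-sound x rep y o =
    ⌊⌋-sound (toℕ x ≤? toℕ y) (⇒-sound (∀-sound _ rep y) (inOrbit-complete x y o))

  isRep-complete : ∀ x → (∀ y → Orbit x y → toℕ x ≤ toℕ y) → isRep H X x ≡ true
  isRep-complete x least-x = ∀-complete _ λ y → ⇒-complete (inOrbit H X x y) λ x~y →
    ⌊⌋-true (toℕ x ≤? toℕ y) (least-x y (inOrbit-sound x y x~y))

  canonical : ∀ x → Σ[ c ∈ Fin n ] inOrbit H X x c ≡ true × (∀ y → inOrbit H X x y ≡ true → toℕ c ≤ toℕ y)
  canonical x = least (inOrbit H X x) x (inOrbit-complete x x (orbit-refl x))

  canon : Fin n → Fin n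
  canon x = proj₁ (canonical x)

  canon-orbit : ∀ x → Orbit x (canon x)
  canon-orbit x = inOrbit-sound x (canon x) (proj₁ (proj₂ (canonical x)))

  canon-least : ∀ x y → Orbit x y → toℕ (canon x) ≤ toℕ y
  canon-least x y o = proj₂ (proj₂ (canonical x)) y (inOrbit-complete x y o)

  canon-cong : ∀ {x y} → Orbit x y → canon x ≡ canon y
  canon-cong {x} {y} o = Fin.toℕ-injective (≤-antisym
    (canon-least x (canon y) (orbit-trans o (canon-orbit y)))
    (canon-least y (canon x) (orbit-trans (orbit-sym o) (canon-orbit x))))

  canon-idem : ∀ x → canon (canon x) ≡ canon x
  canon-idem x = sym (canon-cong (canon-orbit x))

  isRep⇒canon : ∀ x → isRep H X x ≡ true → canon x ≡ x
  isRep⇒canon x rep = Fin.toℕ-injective (≤-antisym (canon-least x x (orbit-refl x)) (isRep-sound x rep (canon x) (canon-orbit x)))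

  canon⇒isRep : ∀ x → canon x ≡ x → isRep H X x ≡ true
  canon⇒isRep x canon-x≡x = isRep-complete x λ y o → subst (λ c → toℕ c ≤ toℕ y) canon-x≡x (canon-least x y o)

  canon-isRep : ∀ x → isRep H X (canon x) ≡ true
  canon-isRep x = canon⇒isRep (canon x) (canon-idem x)

  orbitSize-fibre : ∀ x → isRep H X x ≡ true → orbitSize H X x ≡ count (λ y → does (x Fin.≟ canon y)) (allFin n)
  orbitSize-fibre x rep = count-cong (allFin n) λ y → bool-ext
    (λ x~y → dec-true (x Fin.≟ canon y) (trans (sym (isRep⇒canon x rep)) (canon-cong (inOrbit-sound x y x~y))))
    (λ x≟cy → inOrbit-complete x y (orbit-sym (subst (Orbit y) (sym (does-sound (x Fin.≟ canon y) x≟cy)) (canon-orbit y))))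

  orbitSize-bounds : ∀ x → 1 ≤ orbitSize H X x × orbitSize H X x ≤ n
  orbitSize-bounds x =
    count-pos (Any.tabulate⁺ x (inOrbit-complete x x (orbit-refl x))) ,
    ≤-trans (count-≤-length (inOrbit H X x) (allFin n)) (≤-reflexive (List.length-tabulate id))

  Invariant : ∀ {B : Set} → (Fin n → B) → Set
  Invariant f = ∀ h → mem H h ≡ true → ∀ x → f (act X (inv G h) x) ≡ f x

  invariant⇒canon : ∀ {B : Set} (f : Fin n → B) → Invariant f → ∀ x → f x ≡ f (canon x)
  invariant⇒canon f inv-f x with h , h∈H , hx≡cx ← canon-orbit x = begin
    f x                                ≡⟨ cong f (act-inv h x) ⟨
    f (act X (inv G h) (act X h x))    ≡⟨ cong (f ∘ act X (inv G h)) hx≡cx ⟩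
    f (act X (inv G h) (canon x))      ≡⟨ inv-f h h∈H (canon x) ⟩
    f (canon x)                        ∎
    where open ≡-Reasoning

  canon⇒invariant : ∀ {B : Set} (f : Fin n → B) → (∀ x → f x ≡ f (canon x)) → Invariant f
  canon⇒invariant f f≡ h h∈H x = trans (f≡ _) (trans (cong f (sym (canon-cong (inv G h , mem-inv H h h∈H , refl)))) (sym (f≡ x)))

eqMaybeFin-does : ∀ {k} (u v : Maybe (Fin k)) → eqMaybeFin u v ≡ does (Maybe.≡-dec Fin._≟_ u v)
eqMaybeFin-does nothing  nothing  = refl
eqMaybeFin-does nothing  (just _) = refl
eqMaybeFin-does (just _) nothing  = refl
eqMaybeFin-does (just x) (just y) = isYes≗does (x Fin.≟ y)

deg-∑ : ∀ {k m} (f : Vec (Maybe (Fin k)) m) → deg f ≡ ∑[ x < m ] degVal (lookup f x)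
deg-∑ []      = refl
deg-∑ (z ∷ f) = cong (degVal z +_) (deg-∑ f)

sizeWeight : ∀ {A : Set} → ℕ → Maybe A → ℕ
sizeWeight s nothing  = 0
sizeWeight s (just _) = s

module Colourings (G : FinGroup) (H : Subgroup G) {n : ℕ} (X : GSet G n) {k : ℕ} where
  open Orbits G H X

  Colouring : Set
  Colouring = Vec (Maybe (Fin k)) n

  _≟ᶜ_ : DecidableEquality (Maybe (Fin k))
  _≟ᶜ_ = Maybe.≡-dec Fin._≟_

  moved-by : Colouring → Fin (order G) → Fin n → Bool
  moved-by f h x = eqMaybeFin (lookup f (act X (inv G h) x)) (lookup f x)

  fixed-by-all : Colouring → Fin (order G) → Bool
  fixed-by-all f h = if mem H h then allL (moved-by f h) (allFin n) else true

  fixed-sound : ∀ f → fixedBy H X f ≡ true → Invariant (lookup f)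
  fixed-sound f fixed h h∈H x =
    does-sound (lookup f (act X (inv G h) x) ≟ᶜ lookup f x)
      (trans (sym (eqMaybeFin-does (lookup f (act X (inv G h) x)) (lookup f x)))
             (∀-sound (moved-by f h) (⇒-sound (∀-sound (fixed-by-all f) fixed h) h∈H) x))

  fixed-complete : ∀ f → Invariant (lookup f) → fixedBy H X f ≡ true
  fixed-complete f inv-f = ∀-complete (fixed-by-all f) λ h → ⇒-complete (mem H h) λ h∈H → ∀-complete (moved-by f h) λ x →
    trans (eqMaybeFin-does (lookup f (act X (inv G h) x)) (lookup f x))
          (dec-true (lookup f (act X (inv G h) x) ≟ᶜ lookup f x) (inv-f h h∈H x))

  supp : Fin n → Maybe (Fin k) → Bool
  supp x z = isRep H X x ∨ is-nothing z

  supported-off : ∀ g → allAt supp g ≡ true → ∀ x → isRep H X x ≡ false → lookup g x ≡ nothing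
  supported-off g supported x not-rep =
    is-nothing-sound (lookup g x) (subst (λ b → b ∨ is-nothing (lookup g x) ≡ true) not-rep (allAt-sound supp g supported x))
    where
    is-nothing-sound : ∀ z → is-nothing z ≡ true → z ≡ nothing
    is-nothing-sound nothing _ = refl

  restrict : Colouring → Colouring
  restrict f = Vec.tabulate λ x → if isRep H X x then lookup f x else nothing

  extend : Colouring → Colouring
  extend g = Vec.tabulate λ x → lookup g (canon x)

  lookup-restrict : ∀ f x → lookup (restrict f) x ≡ (if isRep H X x then lookup f x else nothing)
  lookup-restrict f = Vec.lookup∘tabulate (λ x → if isRep H X x then lookup f x else nothing)

  lookup-extend : ∀ g x → lookup (extend g) x ≡ lookup g (canon x)
  lookup-extend g = Vec.lookup∘tabulate (lookup g ∘ canon)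

  vec-ext : ∀ {u v : Colouring} → (∀ x → lookup u x ≡ lookup v x) → u ≡ v
  vec-ext u≗v = Pointwise-≡⇒≡ (ext u≗v)

  restrict-supported : ∀ f → allAt supp (restrict f) ≡ true
  restrict-supported f = allAt-complete supp (restrict f) λ x →
    subst (λ z → supp x z ≡ true) (sym (lookup-restrict f x)) (admissible (isRep H X x))
    where
    admissible : ∀ {z} b → b ∨ is-nothing (if b then z else nothing) ≡ true
    admissible true  = refl
    admissible false = refl

  extend-fixed : ∀ g → fixedBy H X (extend g) ≡ true
  extend-fixed g = fixed-complete (extend g) (canon⇒invariant (lookup (extend g)) λ x → begin
    lookup (extend g) x          ≡⟨ lookup-extend g x ⟩
    lookup g (canon x)           ≡⟨ cong (lookup g) (canon-idem x) ⟨
    lookup g (canon (canon x))   ≡⟨ lookup-extend g (canon x) ⟨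
    lookup (extend g) (canon x)  ∎)
    where open ≡-Reasoning

  extend-restrict : ∀ f → fixedBy H X f ≡ true → extend (restrict f) ≡ f
  extend-restrict f fixed = vec-ext λ x → begin
    lookup (extend (restrict f)) x
      ≡⟨ lookup-extend (restrict f) x ⟩
    lookup (restrict f) (canon x)
      ≡⟨ lookup-restrict f (canon x) ⟩
    (if isRep H X (canon x) then lookup f (canon x) else nothing)
      ≡⟨ cong (λ b → if b then lookup f (canon x) else nothing) (canon-isRep x) ⟩
    lookup f (canon x)
      ≡⟨ invariant⇒canon (lookup f) (fixed-sound f fixed) x ⟨
    lookup f x ∎
    where open ≡-Reasoning

  restrict-extend : ∀ g → allAt supp g ≡ true → restrict (extend g) ≡ g
  restrict-extend g supported = vec-ext λ x → trans (lookup-restrict (extend g) x) (at x (isRep H X x) refl)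
    where
    at : ∀ x b → isRep H X x ≡ b → (if b then lookup (extend g) x else nothing) ≡ lookup g x
    at x true  rep     = trans (lookup-extend g x) (cong (lookup g) (isRep⇒canon x rep))
    at x false not-rep = sym (supported-off g supported x not-rep)

  restrict-within : ∀ (Good : Maybe (Fin k) → Set) → Good nothing →
                    ∀ f → (∀ x → Good (lookup f x)) → ∀ x → Good (lookup (restrict f) x)
  restrict-within Good good-nothing f good x =
    subst Good (sym (lookup-restrict f x)) (within (isRep H X x))
    where
    within : ∀ b → Good (if b then lookup f x else nothing)
    within true  = good x
    within false = good-nothing

  extend-within : ∀ (Good : Maybe (Fin k) → Set) → ∀ g → (∀ x → Good (lookup g x)) → ∀ x → Good (lookup (extend g) x)
  extend-within Good g good x = subst Good (sym (lookup-extend g x)) (good (canon x))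

  orbitWeight : Fin n → Maybe (Fin k) → ℕ
  orbitWeight x = sizeWeight (orbitSize H X x)

  deg-extend : ∀ g → allAt supp g ≡ true → deg (extend g) ≡ weight orbitWeight g
  deg-extend g supported = begin
    deg (extend g)
      ≡⟨ deg-∑ (extend g) ⟩
    ∑[ y < n ] degVal (lookup (extend g) y)
      ≡⟨ sum-cong-≗ (λ y → cong degVal (lookup-extend g y)) ⟩
    ∑[ y < n ] degVal (lookup g (canon y))
      ≡⟨ ∑-fibres canon (degVal ∘ lookup g) ⟩
    ∑[ x < n ] (fibre x * degVal (lookup g x))
      ≡⟨ sum-cong-≗ (λ x → at x (isRep H X x) refl) ⟩
    weight orbitWeight g ∎
    where
    open ≡-Reasoning
    fibre : Fin n → ℕ
    fibre x = count (λ y → does (x Fin.≟ canon y)) (allFin n)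
    at : ∀ x b → isRep H X x ≡ b → fibre x * degVal (lookup g x) ≡ orbitWeight x (lookup g x)
    at x false not-rep rewrite supported-off g supported x not-rep = *-zeroʳ (fibre x)
    at x true  rep with lookup g x
    ... | nothing = *-zeroʳ (fibre x)
    ... | just _  = trans (*-identityʳ (fibre x)) (sym (orbitSize-fibre x rep))

count-allFin-≟ : ∀ {m} (b : Fin m) → count (λ w → does (w Fin.≟ b)) (allFin m) ≡ 1
count-allFin-≟ b = trans (count-tabulate (λ w → does (w Fin.≟ b)) id) (∑-select b (λ _ → 1))

module Colours {k : ℕ} (a : Fin k) where

  -- the colours: `just a` is excluded, as a is represented by `nothing`
  Good : Maybe (Fin k) → Set
  Good z = z ≢ just a

  codomain-enumerates : Enumerates (Maybe.≡-dec Fin._≟_) Good (codomain a)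
  codomain-enumerates = record { only-good = only-good ; once = once }
    where
    only-good : All Good (codomain a)
    only-good = (λ ()) ∷ All.map⁺ (All.map (λ w≢a → w≢a ∘ Maybe.just-injective) (All.all-filter (λ w → ¬? (w Fin.≟ a)) (allFin k)))
    once : ∀ z → Good z → count (λ y → does (Maybe.≡-dec Fin._≟_ y z)) (codomain a) ≡ 1
    once nothing  _ = cong suc (trans (count-map _ just (A′ a)) (count-false (A′ a) (λ _ → refl)))
    once (just b) b≢a = begin
      count (λ y → does (Maybe.≡-dec Fin._≟_ y (just b))) (map just (A′ a))
        ≡⟨ count-map _ just (A′ a) ⟩
      count (λ w → does (w Fin.≟ b)) (A′ a)
        ≡⟨ count-filter _ (λ w → ¬? (w Fin.≟ a)) (allFin k) ⟩
      count (λ w → not (does (w Fin.≟ a)) ∧ does (w Fin.≟ b)) (allFin k)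
        ≡⟨ count-cong (allFin k) b-is-not-a ⟩
      count (λ w → does (w Fin.≟ b)) (allFin k)
        ≡⟨ count-allFin-≟ b ⟩
      1 ∎
      where
      open ≡-Reasoning
      b-is-not-a : ∀ w → not (does (w Fin.≟ a)) ∧ does (w Fin.≟ b) ≡ does (w Fin.≟ b)
      b-is-not-a w with w Fin.≟ b
      ... | yes refl = cong (_∧ true) (cong not (dec-false (w Fin.≟ a) (b≢a ∘ cong just)))
      ... | no  _    = ∧-zeroʳ _

  colours-count : suc (length (A′ a)) ≡ k
  colours-count = begin
    suc (length (A′ a))
      ≡⟨ +-comm 1 (length (A′ a)) ⟩
    length (A′ a) + 1
      ≡⟨ cong₂ _+_ (length-filter (λ w → ¬? (w Fin.≟ a)) (allFin k)) (sym (count-allFin-≟ a)) ⟩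
    count (not ∘ λ w → does (w Fin.≟ a)) (allFin k) + count (λ w → does (w Fin.≟ a)) (allFin k)
      ≡⟨ count-complement _ (allFin k) ⟩
    length (allFin k)
      ≡⟨ List.length-tabulate id ⟩
    k ∎
    where open ≡-Reasoning

  colour-count : ∀ r → count (λ z → r ∨ is-nothing z) (codomain a) ≡ (if r then k else 1)
  colour-count true  = trans (cong suc (trans (count-map _ just (A′ a)) (trans (count-const true (A′ a)) (+-identityʳ _))))
                             colours-count
  colour-count false = cong suc (trans (count-map _ just (A′ a)) (count-false (A′ a) (λ _ → refl)))

  colour-series : ∀ r s → countS (codomain a) (λ z → r ∨ is-nothing z) (sizeWeight s)
                            ≗ (if r then binomS (length (A′ a)) s else oneS)
  colour-series true s d = cong₂ _+_ (mono-zero d) (begin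
    count (λ z → does (sizeWeight s z ≟ d)) (map just (A′ a))
      ≡⟨ count-map _ just (A′ a) ⟩
    count (λ _ → does (s ≟ d)) (A′ a)
      ≡⟨ count-const (does (s ≟ d)) (A′ a) ⟩
    𝟙 (does (s ≟ d)) * length (A′ a)
      ≡⟨ if-then-0 (does (s ≟ d)) (length (A′ a)) ⟨
    (if does (s ≟ d) then length (A′ a) else 0)
      ≡⟨ cong (λ b → if b then length (A′ a) else 0) (trans (does-sym _≟_ s d) (sym (isYes≗does (d ≟ s)))) ⟩
    (if ⌊ d ≟ s ⌋ then length (A′ a) else 0) ∎)
    where open ≡-Reasoning
  colour-series false s d =
    trans (cong₂ _+_ (mono-zero d) (trans (count-map _ just (A′ a)) (count-false (A′ a) (λ _ → refl)))) (+-identityʳ (oneS d))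

module FixedColourings (G : FinGroup) {n : ℕ} (X : GSet G n) (H : Subgroup G) {k : ℕ} (a : Fin k) where
  open Orbits G H X
  open Colourings G H X {k}
  open Colours a

  fixed≡supported : ∀ (R : Colouring → Bool) →
                    count (λ f → fixedBy H X f ∧ R f) (J a n) ≡ count (λ g → allAt supp g ∧ R (extend g)) (J a n)
  fixed≡supported R =
    count-bijection (allVecs-enumerates codomain-enumerates n) restrict extend
      (restrict-within Good (λ ())) (extend-within Good) _ _ to from
    where
    to : ∀ f → fixedBy H X f ∧ R f ≡ true → allAt supp (restrict f) ∧ R (extend (restrict f)) ≡ true × extend (restrict f) ≡ f
    to f h with fixed , Rf ← ∧-sound h =
      ∧-complete (restrict-supported f) (subst (λ u → R u ≡ true) (sym (extend-restrict f fixed)) Rf) , extend-restrict f fixed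
    from : ∀ g → allAt supp g ∧ R (extend g) ≡ true → fixedBy H X (extend g) ∧ R (extend g) ≡ true × restrict (extend g) ≡ g
    from g h with supported , R-ext ← ∧-sound h = ∧-complete (extend-fixed g) R-ext , restrict-extend g supported

  fixed-by-degree : ∀ N d → d ≤ N →
                    φJ^ H X a d ≡ prodS N (λ i → powS (binomS (length (A′ a)) i) (numOrbitsOfSize H X i)) d
  fixed-by-degree N d d≤N = begin
    count (λ f → fixedBy H X f ∧ ⌊ deg f ≟ d ⌋) (J a n)
      ≡⟨ fixed≡supported (λ f → ⌊ deg f ≟ d ⌋) ⟩
    count (λ g → allAt supp g ∧ ⌊ deg (extend g) ≟ d ⌋) (J a n)
      ≡⟨ count-cong (J a n) (λ g → degree-is-weight g (allAt supp g) refl) ⟩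
    count (λ g → allAt supp g ∧ does (weight orbitWeight g ≟ d)) (J a n)
      ≡⟨ vectors-series (codomain a) n supp orbitWeight d ⟩
    ∏ₛ n (λ x → countS (codomain a) (supp x) (orbitWeight x)) d
      ≡⟨ ∏ₛ-cong n (λ x → colour-series (isRep H X x) (orbitSize H X x)) d ⟩
    ∏ₛ n (λ x → if isRep H X x then B (orbitSize H X x) else oneS) d
      ≡⟨ ∏ₛ-group B (N + n) (isRep H X) (orbitSize H X) (λ x _ → orbit-fits x) d ⟩
    prodS (N + n) (λ i → powS (B i) (numOrbitsOfSize H X i)) d
      ≡⟨ prodS-truncate N _ (N + n) (≤⇒≤′ (m≤m+n N n)) large-orbits d d≤N ⟩
    prodS N (λ i → powS (B i) (numOrbitsOfSize H X i)) d ∎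
    where
    open ≡-Reasoning
    B : ℕ → Series
    B = binomS (length (A′ a))
    orbit-fits : ∀ x → 1 ≤ orbitSize H X x × orbitSize H X x ≤ N + n
    orbit-fits x = proj₁ (orbitSize-bounds x) , ≤-trans (proj₂ (orbitSize-bounds x)) (m≤n+m n N)
    degree-is-weight : ∀ g b → allAt supp g ≡ b →
                       b ∧ ⌊ deg (extend g) ≟ d ⌋ ≡ b ∧ does (weight orbitWeight g ≟ d)
    degree-is-weight g true  supported = trans (isYes≗does (deg (extend g) ≟ d)) (cong (λ m → does (m ≟ d)) (deg-extend g supported))
    degree-is-weight g false _         = refl
    -- orbits of size i > N only contribute in degrees ≥ i
    large-orbits : ∀ i → N < i → ∀ e → e ≤ N → powS (B i) (numOrbitsOfSize H X i) e ≡ oneS e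
    large-orbits i N<i = powS-one-≤ N (B i) (λ e e≤N → binomS-below (length (A′ a)) i e (≤-<-trans e≤N N<i)) (numOrbitsOfSize H X i)

  -- second claim: k choices of colour for each orbit
  fixed-count : φJ H X a ≡ k ^ numOrbits H X
  fixed-count = begin
    count (fixedBy H X) (J a n)                          ≡⟨ count-cong (J a n) (λ f → ∧-identityʳ (fixedBy H X f)) ⟨
    count (λ f → fixedBy H X f ∧ true) (J a n)           ≡⟨ fixed≡supported (λ _ → true) ⟩
    count (λ g → allAt supp g ∧ true) (J a n)            ≡⟨ count-cong (J a n) (λ g → ∧-identityʳ (allAt supp g)) ⟩
    count (allAt supp) (J a n)                           ≡⟨ count-allAt (codomain a) supp (isRep H X) k (colour-count ∘ isRep H X) ⟩
    k ^ numOrbits H X                                    ∎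
    where open ≡-Reasoning

theorem3p15 : (G : FinGroup) {n : ℕ} (X : GSet G n) (H : Subgroup G)
    (k : ℕ) → 2 ≤ k → (a : Fin k) →
    ((N d : ℕ) → d ≤ N →
      φJ^ H X a d
        ≡ prodS N (λ i → powS (binomS (length (A′ a)) i) (numOrbitsOfSize H X i)) d)
    × (φJ H X a ≡ k ^ numOrbits H X)
theorem3p15 G X H k _ a = FixedColourings.fixed-by-degree G X H a , FixedColourings.fixed-count G X H a
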